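{- Let $2 \le m \le k-1$, let $H$ be a finite $k$-uniform hypergraph with $\nu^{(m)}(H) = 1$, let $e$ be an edge of $H$, and set $m' = \max\{0, 2m-k\}$. For any set $S \subseteq \binom{e}{m}$ of $m$-subsets of $e$ with $|S| > \frac{1}{2}\binom{k}{m}$, there exist distinct $a, b \in S$ with $|a \cap b| = m'$.
   Context: An $m$-matching of a $k$-uniform hypergraph $H$ is a set $M$ of edges with $|f \cap f'| < m$ for all distinct $f,f' \in M$; $\nu^{(m)}(H)$ is the maximum size of an $m$-matching. -}

module Defs where

open import Data.Nat using (ℕ; _<_; _≤_)
open import Data.Fin.Subset using (Subset; _∩_; ∣_∣)
open import Data.List using (List; length)
open import Data.List.Membership.Propositional using (_∈_)
open import Data.List.Relation.Unary.All using (All)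
open import Data.List.Relation.Unary.AllPairs using (AllPairs)
open import Data.List.Relation.Unary.Unique.Propositional using (Unique)
open import Data.Product using (Σ; _×_)
open import Relation.Binary.PropositionalEquality using (_≡_)

record Hypergraph (n : ℕ) : Set where
  field
    edges  : List (Subset n)
    unique : Unique edges
open Hypergraph public

IsUniform : {n : ℕ} → ℕ → Hypergraph n → Set
IsUniform k H = All (λ f → ∣ f ∣ ≡ k) (edges H)

IsMMatching : {n : ℕ} → ℕ → Hypergraph n → List (Subset n) → Set
IsMMatching m H M =
  Unique M × All (λ f → f ∈ edges H) M × AllPairs (λ f f' → ∣ f ∩ f' ∣ < m) M

MatchingNumber≡ : {n : ℕ} → ℕ → Hypergraph n → ℕ → Set
MatchingNumber≡ m H j =
  Σ (List _) (λ M → IsMMatching m H M × length M ≡ j)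
  × (∀ M → IsMMatching m H M → length M ≤ j)

{-# OPTIONS --safe #-}
module Submission where

-- If 2m ≤ k, an intersecting family of
-- m-subsets of a k-set contains at most half of them. For k = 2m, a set and its
-- complement cannot both belong to it. For k > 2m, average over the points x of e:
-- the members avoiding x form an intersecting family of m-subsets of e ∖ {x}, and
-- each member avoids k - m points, so 2(k - m)|S| ≤ k·C(k - 1, m) = (k - m)·C(k, m).
-- Hence S contains two disjoint sets. If 2m > k, apply this to the complements e ∖ a,
-- which have k - m ≤ k/2 elements: disjoint complements e ∖ a, e ∖ b mean
-- |a ∩ b| = 2m - k. The two sets are distinct because 2m ∸ k < m = |a ∩ a|.

open import Defs
open import Data.Nat using (ℕ; _≤_; _<_; _*_; _∸_; _+_)
open import Data.Nat.Combinatorics using (_C_)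
open import Data.Fin.Subset using (Subset; _∩_; _⊆_; ∣_∣)
open import Data.List using (List; length)
open import Data.List.Membership.Propositional using (_∈_)
open import Data.List.Relation.Unary.All using (All)
open import Data.List.Relation.Unary.Unique.Propositional using (Unique)
open import Data.Product using (Σ; _×_)
open import Relation.Binary.PropositionalEquality using (_≡_; _≢_)

open import Data.Bool.Base using (true; false; if_then_else_)
import Data.Bool.Properties as Bool
open import Data.Empty using (⊥-elim)
open import Data.Fin.Base using (Fin; zero; suc)
open import Data.Fin.Subset using (Side; inside; outside; _─_; _-_; _⊈_)
  renaming (_∈_ to _∈ₛ_; _∉_ to _∉ₛ_; ⊥ to ∅)
open import Data.Fin.Subset.Properties
  using ( _∈?_; drop-∷-⊆; ∩-idem; x∈p∩q⁺; ∉⊥; ∣⊥∣≡0; p─q⊆p; x∈p∧x≢y⇒x∈p-y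
        ; x∈⁅y⁆⇒x≡y; ∣⁅x⁆∣≡1)
open import Data.List using ([]; _∷_; map; _++_; filter)
open import Data.List.Membership.Propositional using (find; lose)
open import Data.List.Membership.Propositional.Properties using (∈-map⁻; ∈-filter⁻)
open import Data.List.Properties using (length-++; length-map; map-∘; map-id-local; filter-none)
open import Data.List.Relation.Unary.All using ([]; _∷_)
import Data.List.Relation.Unary.All as All
import Data.List.Relation.Unary.All.Properties as All
open import Data.List.Relation.Unary.AllPairs using ([]; _∷_)
open import Data.List.Relation.Unary.Any using (here; there; any?)
import Data.List.Relation.Unary.Unique.Propositional.Properties as Unique
open import Data.Nat using (zero; suc; z≤n; s≤s; _≤′_; ≤′-step; ≤′-refl; >-nonZero; _≟_; _≤?_)
open import Data.Nat.Combinatorics using (nCk+nC[k+1]≡[n+1]C[k+1]; nC1≡n; nCk≡nC[n∸k])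
open import Data.Nat.Properties
open import Algebra.Properties.Semiring.Sum +-*-semiring
  using (sum-syntax; sum-cong-≗; sum-replicate-zero; ∑-distrib-+; *-distribˡ-sum; *-distribʳ-sum)
open import Data.Product using (∃₂; _,_; proj₁; proj₂)
import Data.Product as Product
open import Data.Sum using (_⊎_; inj₁; inj₂)
open import Data.Vec.Base using (_∷_; []) renaming (here to hereᵥ)
open import Function.Base using (_∘_)
open import Relation.Binary.PropositionalEquality
  using (refl; sym; trans; cong; cong₂; subst; subst₂; module ≡-Reasoning)
open import Relation.Nullary using (Dec; does; yes; no; ¬_; contradiction)
open import Relation.Unary using (Decidable)

2*n≡n+n : ∀ n → 2 * n ≡ n + n
2*n≡n+n n = cong (n +_) (+-identityʳ n)

2*[n∸m]≤n : ∀ {m n} → m ≤ n → n ≤ 2 * m → 2 * (n ∸ m) ≤ n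
2*[n∸m]≤n {m} {n} m≤n n≤2m = begin
  2 * (n ∸ m)         ≡⟨ 2*n≡n+n (n ∸ m) ⟩
  (n ∸ m) + (n ∸ m)   ≤⟨ +-monoʳ-≤ (n ∸ m) (m≤n+o⇒m∸n≤o n m (subst (n ≤_) (2*n≡n+n m) n≤2m)) ⟩
  (n ∸ m) + m         ≡⟨ m∸n+n≡m m≤n ⟩
  n                   ∎
  where open ≤-Reasoning

2*m∸n<m : ∀ {m n} → 0 < m → m < n → 2 * m ∸ n < m
2*m∸n<m {m} {n} 0<m m<n = m<n+o⇒m∸n<o (2 * m) n {{>-nonZero 0<m}}
  (subst (_< n + m) (sym (2*n≡n+n m)) (+-monoˡ-< m m<n))

m≤n∸1⇒m<n : ∀ {m n} → 0 < m → m ≤ n ∸ 1 → m < n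
m≤n∸1⇒m<n {n = zero}  0<m m≤0 = contradiction m≤0 (<⇒≱ 0<m)
m≤n∸1⇒m<n {n = suc n} _   m≤n = s≤s m≤n

[k+1]*[n+1]C[k+1]≡[n+1]*nCk : ∀ n k → suc k * (suc n C suc k) ≡ suc n * (n C k)
[k+1]*[n+1]C[k+1]≡[n+1]*nCk zero    zero    = refl
[k+1]*[n+1]C[k+1]≡[n+1]*nCk zero    (suc k) = *-zeroʳ (suc (suc k))
[k+1]*[n+1]C[k+1]≡[n+1]*nCk (suc n) zero    =
  trans (+-identityʳ _) (trans (nC1≡n (suc (suc n))) (sym (*-identityʳ (suc (suc n)))))
[k+1]*[n+1]C[k+1]≡[n+1]*nCk (suc n) (suc k) = begin
  suc (suc k) * (suc (suc n) C suc (suc k))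
    ≡⟨ cong (suc (suc k) *_) (sym (nCk+nC[k+1]≡[n+1]C[k+1] (suc n) (suc k))) ⟩
  suc (suc k) * (X + Y)
    ≡⟨ *-distribˡ-+ (suc (suc k)) X Y ⟩
  X + suc k * X + suc (suc k) * Y
    ≡⟨ cong₂ (λ u v → X + u + v) ([k+1]*[n+1]C[k+1]≡[n+1]*nCk n k) ([k+1]*[n+1]C[k+1]≡[n+1]*nCk n (suc k)) ⟩
  X + suc n * (n C k) + suc n * (n C suc k)
    ≡⟨ +-assoc X _ _ ⟩
  X + (suc n * (n C k) + suc n * (n C suc k))
    ≡⟨ cong (X +_) (sym (*-distribˡ-+ (suc n) (n C k) (n C suc k))) ⟩
  X + suc n * (n C k + n C suc k)
    ≡⟨ cong (λ u → X + suc n * u) (nCk+nC[k+1]≡[n+1]C[k+1] n k) ⟩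
  suc (suc n) * X
    ∎
  where
  open ≡-Reasoning
  X Y : ℕ
  X = suc n C suc k
  Y = suc n C suc (suc k)

[n+1∸k]*[n+1]Ck≡[n+1]*nCk : ∀ n k → (suc n ∸ k) * (suc n C k) ≡ suc n * (n C k)
[n+1∸k]*[n+1]Ck≡[n+1]*nCk n zero    = refl
[n+1∸k]*[n+1]Ck≡[n+1]*nCk n (suc k) = begin
  (n ∸ k) * Z
    ≡⟨ *-distribʳ-∸ Z (suc n) (suc k) ⟩
  suc n * Z ∸ suc k * Z
    ≡⟨ cong (λ u → suc n * u ∸ suc k * Z) (sym (nCk+nC[k+1]≡[n+1]C[k+1] n k)) ⟩
  suc n * (n C k + n C suc k) ∸ suc k * Z
    ≡⟨ cong (_∸ suc k * Z) (*-distribˡ-+ (suc n) (n C k) (n C suc k)) ⟩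
  suc n * (n C k) + suc n * (n C suc k) ∸ suc k * Z
    ≡⟨ cong (λ u → u + suc n * (n C suc k) ∸ suc k * Z) ([k+1]*[n+1]C[k+1]≡[n+1]*nCk n k) ⟨
  suc k * Z + suc n * (n C suc k) ∸ suc k * Z
    ≡⟨ m+n∸m≡n (suc k * Z) _ ⟩
  suc n * (n C suc k)
    ∎
  where
  open ≡-Reasoning
  Z : ℕ
  Z = suc n C suc k

in⊈out : ∀ {n} {p q : Subset n} → inside ∷ p ⊈ outside ∷ q
in⊈out p⊆q with p⊆q hereᵥ
... | ()

q∩[p─q]≡∅ : ∀ {n} (p q : Subset n) → q ∩ (p ─ q) ≡ ∅
q∩[p─q]≡∅ []      []            = refl
q∩[p─q]≡∅ (_ ∷ p) (inside  ∷ q) = cong (outside ∷_) (q∩[p─q]≡∅ p q)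
q∩[p─q]≡∅ (_ ∷ p) (outside ∷ q) = cong (outside ∷_) (q∩[p─q]≡∅ p q)

∣q∩[p─q]∣≡0 : ∀ {n} (p q : Subset n) → ∣ q ∩ (p ─ q) ∣ ≡ 0
∣q∩[p─q]∣≡0 {n} p q = trans (cong ∣_∣ (q∩[p─q]≡∅ p q)) (∣⊥∣≡0 n)

x∈p─q⇒x∉q : ∀ {n} {x : Fin n} (p q : Subset n) → x ∈ₛ p ─ q → x ∉ₛ q
x∈p─q⇒x∉q p q x∈p─q x∈q = ∉⊥ (subst (_ ∈ₛ_) (q∩[p─q]≡∅ p q) (x∈p∩q⁺ (x∈q , x∈p─q)))

∣p─q∣+∣q∣≡∣p∣ : ∀ {n} {p q : Subset n} → q ⊆ p → ∣ p ─ q ∣ + ∣ q ∣ ≡ ∣ p ∣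
∣p─q∣+∣q∣≡∣p∣ {p = []}          {[]}          _   = refl
∣p─q∣+∣q∣≡∣p∣ {p = outside ∷ p} {outside ∷ q} q⊆p = ∣p─q∣+∣q∣≡∣p∣ (drop-∷-⊆ q⊆p)
∣p─q∣+∣q∣≡∣p∣ {p = outside ∷ p} {inside  ∷ q} q⊆p = ⊥-elim (in⊈out q⊆p)
∣p─q∣+∣q∣≡∣p∣ {p = inside  ∷ p} {outside ∷ q} q⊆p = cong suc (∣p─q∣+∣q∣≡∣p∣ (drop-∷-⊆ q⊆p))
∣p─q∣+∣q∣≡∣p∣ {p = inside  ∷ p} {inside  ∷ q} q⊆p =
  trans (+-suc _ _) (cong suc (∣p─q∣+∣q∣≡∣p∣ (drop-∷-⊆ q⊆p)))

∣p─q∣≡∣p∣∸∣q∣ : ∀ {n} {p q : Subset n} → q ⊆ p → ∣ p ─ q ∣ ≡ ∣ p ∣ ∸ ∣ q ∣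
∣p─q∣≡∣p∣∸∣q∣ {p = p} {q} q⊆p =
  trans (sym (m+n∸n≡m ∣ p ─ q ∣ ∣ q ∣)) (cong (_∸ ∣ q ∣) (∣p─q∣+∣q∣≡∣p∣ q⊆p))

p─[p─q]≡q : ∀ {n} {p q : Subset n} → q ⊆ p → p ─ (p ─ q) ≡ q
p─[p─q]≡q {p = []}          {[]}          _   = refl
p─[p─q]≡q {p = outside ∷ p} {outside ∷ q} q⊆p = cong (outside ∷_) (p─[p─q]≡q (drop-∷-⊆ q⊆p))
p─[p─q]≡q {p = outside ∷ p} {inside  ∷ q} q⊆p = ⊥-elim (in⊈out q⊆p)
p─[p─q]≡q {p = inside  ∷ p} {outside ∷ q} q⊆p = cong (outside ∷_) (p─[p─q]≡q (drop-∷-⊆ q⊆p))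
p─[p─q]≡q {p = inside  ∷ p} {inside  ∷ q} q⊆p = cong (inside ∷_) (p─[p─q]≡q (drop-∷-⊆ q⊆p))

∣p-x∣≡∣p∣∸1 : ∀ {n} {p : Subset n} {x} → x ∈ₛ p → ∣ p - x ∣ ≡ ∣ p ∣ ∸ 1
∣p-x∣≡∣p∣∸1 {p = p} {x} x∈p =
  trans (∣p─q∣≡∣p∣∸∣q∣ (λ y∈⁅x⁆ → subst (_∈ₛ p) (sym (x∈⁅y⁆⇒x≡y x y∈⁅x⁆)) x∈p))
        (cong (∣ p ∣ ∸_) (∣⁅x⁆∣≡1 x))

⊆-remove : ∀ {n} {p q : Subset n} {x} → q ⊆ p → x ∉ₛ q → q ⊆ p - x
⊆-remove {x = x} q⊆p x∉q {y} y∈q = x∈p∧x≢y⇒x∈p-y (q⊆p y∈q) (λ { refl → x∉q y∈q })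

∣p∩q∣+∣r∣≡∣[r─p]∩[r─q]∣+∣p∣+∣q∣ : ∀ {n} {p q r : Subset n} → p ⊆ r → q ⊆ r →
                                   ∣ p ∩ q ∣ + ∣ r ∣ ≡ ∣ (r ─ p) ∩ (r ─ q) ∣ + ∣ p ∣ + ∣ q ∣
∣p∩q∣+∣r∣≡∣[r─p]∩[r─q]∣+∣p∣+∣q∣ {p = []} {[]} {[]} _ _ = refl
∣p∩q∣+∣r∣≡∣[r─p]∩[r─q]∣+∣p∣+∣q∣ {p = s ∷ p} {t ∷ q} {r₀ ∷ r} p⊆r q⊆r
  with IH ← ∣p∩q∣+∣r∣≡∣[r─p]∩[r─q]∣+∣p∣+∣q∣ (drop-∷-⊆ p⊆r) (drop-∷-⊆ q⊆r) | s | t | r₀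
... | outside | outside | outside = IH
... | inside  | _       | outside = ⊥-elim (in⊈out p⊆r)
... | outside | inside  | outside = ⊥-elim (in⊈out q⊆r)
... | outside | outside | inside  = trans (+-suc _ _) (cong suc IH)
... | inside  | outside | inside  = trans (+-suc _ _) (trans (cong suc IH) (cong (_+ ∣ q ∣) (sym (+-suc _ ∣ p ∣))))
... | outside | inside  | inside  = trans (+-suc _ _) (trans (cong suc IH) (sym (+-suc _ ∣ q ∣)))
... | inside  | inside  | inside  = trans (cong suc (trans (+-suc _ _) (cong suc IH)))
      (sym (trans (+-suc _ ∣ q ∣) (cong (λ u → suc (u + ∣ q ∣)) (+-suc _ ∣ p ∣))))

Family : ∀ {n} → ℕ → Subset n → List (Subset n) → Set
Family m e S = All (λ a → a ⊆ e × ∣ a ∣ ≡ m) S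

Intersecting : ∀ {n} → List (Subset n) → Set
Intersecting S = ∀ {a b} → a ∈ S → b ∈ S → ∣ a ∩ b ∣ ≢ 0

PairMeetingIn : ∀ {n} → ℕ → List (Subset n) → Set
PairMeetingIn t S = ∃₂ λ a b → a ∈ S × b ∈ S × ∣ a ∩ b ∣ ≡ t

tailsWith : ∀ {n} → Side → List (Subset (suc n)) → List (Subset n)
tailsWith s []            = []
tailsWith s ((t ∷ a) ∷ S) with t Bool.≟ s
... | yes _ = a ∷ tailsWith s S
... | no  _ = tailsWith s S

∈-tailsWith⁻ : ∀ {n s} {a : Subset n} S → a ∈ tailsWith s S → (s ∷ a) ∈ S
∈-tailsWith⁻ {s = s} ((t ∷ b) ∷ S) a∈ with t Bool.≟ s
∈-tailsWith⁻ ((t ∷ b) ∷ S) (here refl) | yes refl = here refl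
∈-tailsWith⁻ ((t ∷ b) ∷ S) (there a∈)  | yes refl = there (∈-tailsWith⁻ S a∈)
∈-tailsWith⁻ ((t ∷ b) ∷ S) a∈          | no  _    = there (∈-tailsWith⁻ S a∈)

tailsWith-unique : ∀ {n} s {S : List (Subset (suc n))} → Unique S → Unique (tailsWith s S)
tailsWith-unique s {[]}          []                 = []
tailsWith-unique s {(t ∷ a) ∷ S} (a∉S ∷ unique) with t Bool.≟ s
... | yes refl = All.tabulate (λ b∈ a≡b → All.lookup a∉S (∈-tailsWith⁻ S b∈) (cong (t ∷_) a≡b))
               ∷ tailsWith-unique s unique
... | no  _    = tailsWith-unique s unique

length-tailsWith : ∀ {n} (S : List (Subset (suc n))) →
                   length S ≡ length (tailsWith inside S) + length (tailsWith outside S)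
length-tailsWith []                  = refl
length-tailsWith ((inside  ∷ _) ∷ S) = cong suc (length-tailsWith S)
length-tailsWith ((outside ∷ _) ∷ S) = trans (cong suc (length-tailsWith S)) (sym (+-suc _ _))

tailsWith-family : ∀ {n m s t} {e : Subset n} S → Family m (t ∷ e) S →
                   All (λ a → s ∷ a ⊆ t ∷ e × ∣ s ∷ a ∣ ≡ m) (tailsWith s S)
tailsWith-family S family = All.tabulate (λ a∈ → All.lookup family (∈-tailsWith⁻ S a∈))

tailsWith-outside-family : ∀ {n m t} {e : Subset n} S → Family m (t ∷ e) S → Family m e (tailsWith outside S)
tailsWith-outside-family S family = All.map (Product.map₁ drop-∷-⊆) (tailsWith-family S family)

All⊥⇒length≡0 : ∀ {A : Set} {P : A → Set} {xs} → (∀ {x} → ¬ P x) → All P xs → length xs ≡ 0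
All⊥⇒length≡0 ¬P []      = refl
All⊥⇒length≡0 ¬P (p ∷ _) = contradiction p ¬P

length-tailsWith-≤ : ∀ {n} (S : List (Subset (suc n))) {x y} →
                     length (tailsWith inside S) ≤ x → length (tailsWith outside S) ≤ y → length S ≤ x + y
length-tailsWith-≤ S ≤x ≤y = ≤-trans (≤-reflexive (length-tailsWith S)) (+-mono-≤ ≤x ≤y)

family-bound : ∀ {n} m (e : Subset n) {S} → Unique S → Family m e S → length S ≤ ∣ e ∣ C m
family-bound _ [] {[]}          _                _                 = z≤n
family-bound _ [] {[] ∷ []}     _                ((_ , refl) ∷ []) = ≤-refl
family-bound _ [] {[] ∷ [] ∷ _} ((≢[] ∷ _) ∷ _) _                 = contradiction refl ≢[]
family-bound m (outside ∷ e) {S} unique family = length-tailsWith-≤ S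
  (≤-reflexive (All⊥⇒length≡0 (in⊈out ∘ proj₁) (tailsWith-family S family)))
  (family-bound m e (tailsWith-unique outside unique) (tailsWith-outside-family S family))
family-bound zero (inside ∷ e) {S} unique family = length-tailsWith-≤ S
  (≤-reflexive (All⊥⇒length≡0 (λ ()) (All.map proj₂ (tailsWith-family S family))))
  (family-bound zero e (tailsWith-unique outside unique) (tailsWith-outside-family S family))
family-bound (suc m) (inside ∷ e) {S} unique family = ≤-trans
  (length-tailsWith-≤ S
    (family-bound m e (tailsWith-unique inside unique)
      (All.map (Product.map drop-∷-⊆ suc-injective) (tailsWith-family S family)))
    (family-bound (suc m) e (tailsWith-unique outside unique) (tailsWith-outside-family S family)))
  (≤-reflexive (nCk+nC[k+1]≡[n+1]C[k+1] ∣ e ∣ m))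

complements-family : ∀ {n m} {e : Subset n} {S} → Family m e S → Family (∣ e ∣ ∸ m) e (map (e ─_) S)
complements-family {m = m} {e} family = All.map⁺ (All.map complement family)
  where
  complement : ∀ {a} → a ⊆ e × ∣ a ∣ ≡ m → e ─ a ⊆ e × ∣ e ─ a ∣ ≡ ∣ e ∣ ∸ m
  complement {a} (a⊆e , ∣a∣≡m) = p─q⊆p e a , trans (∣p─q∣≡∣p∣∸∣q∣ a⊆e) (cong (∣ e ∣ ∸_) ∣a∣≡m)

complements-unique : ∀ {n} {e : Subset n} {S} → All (_⊆ e) S → Unique S → Unique (map (e ─_) S)
complements-unique {e = e} {S} S⊆e unique =
  Unique.map⁻ {f = e ─_} {xs = map (e ─_) S} (subst Unique (sym involutive) unique)
  where
  involutive : map (e ─_) (map (e ─_) S) ≡ S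
  involutive = trans (sym (map-∘ S)) (map-id-local (All.map p─[p─q]≡q S⊆e))

indicator : ∀ {ℓ} {P : Set ℓ} → Dec P → ℕ
indicator P? = if does P? then 1 else 0

∑-indicator-∈ : ∀ {n} (p : Subset n) → ∑[ x < n ] indicator (x ∈? p) ≡ ∣ p ∣
∑-indicator-∈ []            = refl
∑-indicator-∈ (inside  ∷ p) = cong suc (∑-indicator-∈ p)
∑-indicator-∈ (outside ∷ p) = ∑-indicator-∈ p

∑-mono-≤ : ∀ {n} {f g : Fin n → ℕ} → (∀ i → f i ≤ g i) → ∑[ i < n ] f i ≤ ∑[ i < n ] g i
∑-mono-≤ {zero}  _   = z≤n
∑-mono-≤ {suc n} f≤g = +-mono-≤ (f≤g zero) (∑-mono-≤ (f≤g ∘ suc))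

length-filter-∷ : ∀ {A : Set} {P : A → Set} (P? : Decidable P) a xs →
                  length (filter P? (a ∷ xs)) ≡ indicator (P? a) + length (filter P? xs)
length-filter-∷ P? a xs with does (P? a)
... | true  = refl
... | false = refl

∑-length-filter-∈ : ∀ {A : Set} {n r} (f : A → Subset n) xs → All (λ a → ∣ f a ∣ ≡ r) xs →
                    ∑[ x < n ] length (filter (λ a → x ∈? f a) xs) ≡ length xs * r
∑-length-filter-∈ {n = n} f []       []               = sum-replicate-zero n
∑-length-filter-∈ {n = n} f (a ∷ xs) (∣fa∣≡r ∷ sizes) = begin
  ∑[ x < n ] length (filter (λ b → x ∈? f b) (a ∷ xs))
    ≡⟨ sum-cong-≗ (λ x → length-filter-∷ (λ b → x ∈? f b) a xs) ⟩
  ∑[ x < n ] (indicator (x ∈? f a) + length (filter (λ b → x ∈? f b) xs))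
    ≡⟨ ∑-distrib-+ (λ x → indicator (x ∈? f a)) (λ x → length (filter (λ b → x ∈? f b) xs)) ⟩
  ∑[ x < n ] indicator (x ∈? f a) + ∑[ x < n ] length (filter (λ b → x ∈? f b) xs)
    ≡⟨ cong₂ _+_ (trans (∑-indicator-∈ (f a)) ∣fa∣≡r) (∑-length-filter-∈ f xs sizes) ⟩
  length (a ∷ xs) * _ ∎
  where open ≡-Reasoning

IntersectingBound : ℕ → ℕ → Set
IntersectingBound m k = ∀ {n} {e : Subset n} {S} → ∣ e ∣ ≡ k →
  Unique S → Family m e S → Intersecting S → 2 * length S ≤ k C m

intersecting-bound-base : ∀ m → IntersectingBound m (2 * m)
intersecting-bound-base m {e = e} {S} ∣e∣≡2m unique family intersecting = begin
  2 * length S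
    ≡⟨ 2*n≡n+n (length S) ⟩
  length S + length S
    ≡⟨ cong (length S +_) (length-map (e ─_) S) ⟨
  length S + length (map (e ─_) S)
    ≡⟨ length-++ S ⟨
  length (S ++ map (e ─_) S)
    ≤⟨ family-bound m e (Unique.++⁺ unique (complements-unique S⊆e unique) disjoint) (All.++⁺ family complements) ⟩
  ∣ e ∣ C m
    ≡⟨ cong (_C m) ∣e∣≡2m ⟩
  2 * m C m
    ∎
  where
  open ≤-Reasoning
  S⊆e : All (_⊆ e) S
  S⊆e = All.map proj₁ family
  complements : Family m e (map (e ─_) S)
  complements = subst (λ m′ → Family m′ e (map (e ─_) S))
    (trans (cong (_∸ m) (trans ∣e∣≡2m (2*n≡n+n m))) (m+n∸n≡m m m)) (complements-family family)
  disjoint : ∀ {a} → ¬ (a ∈ S × a ∈ map (e ─_) S)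
  disjoint (a∈S , a∈S̄) with ∈-map⁻ (e ─_) a∈S̄
  ... | b , b∈S , refl = intersecting b∈S a∈S (∣q∩[p─q]∣≡0 e b)

-- Filtering on x ∈ e ─ a rather than on x ∉ a makes the list empty for x ∉ e,
-- so sums over all of Fin n only see the points of e.
avoiding : ∀ {n} → Fin n → Subset n → List (Subset n) → List (Subset n)
avoiding x e S = filter (λ a → x ∈? e ─ a) S

∈-avoiding⁻ : ∀ {n} {x : Fin n} {e a S} → a ∈ avoiding x e S → a ∈ S × x ∈ₛ e ─ a
∈-avoiding⁻ {x = x} {e} = ∈-filter⁻ (λ a → x ∈? e ─ a)

avoiding-family : ∀ {n m} {x : Fin n} {e S} → Family m e S → Family m (e - x) (avoiding x e S)
avoiding-family {m = m} {x} {e} {S} family = All.tabulate member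
  where
  member : ∀ {a} → a ∈ avoiding x e S → a ⊆ e - x × ∣ a ∣ ≡ m
  member {a} a∈ with a∈S , x∈e─a ← ∈-avoiding⁻ a∈ with a⊆e , ∣a∣≡m ← All.lookup family a∈S =
    ⊆-remove a⊆e (x∈p─q⇒x∉q e a x∈e─a) , ∣a∣≡m

avoiding-bound : ∀ {m k} → IntersectingBound m k →
                 ∀ {n} {e : Subset n} {S} → ∣ e ∣ ≡ suc k → Unique S → Family m e S → Intersecting S →
                 ∀ x → 2 * length (avoiding x e S) ≤ indicator (x ∈? e) * (k C m)
avoiding-bound {m} {k} bound {e = e} {S} ∣e∣≡1+k unique family intersecting x with x ∈? e
... | no x∉e = ≤-reflexive (cong (λ T → 2 * length T)
      (filter-none (λ a → x ∈? e ─ a) {S} (All.tabulate (λ {a} _ → x∉e ∘ p─q⊆p e a))))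
... | yes x∈e = subst (2 * length (avoiding x e S) ≤_) (sym (+-identityʳ (k C m)))
      (bound (trans (∣p-x∣≡∣p∣∸1 x∈e) (cong (_∸ 1) ∣e∣≡1+k))
             (Unique.filter⁺ (λ a → x ∈? e ─ a) unique)
             (avoiding-family family)
             (λ a∈ b∈ → intersecting (proj₁ (∈-avoiding⁻ a∈)) (proj₁ (∈-avoiding⁻ b∈))))

intersecting-bound-step : ∀ {m k} → m ≤ k → IntersectingBound m k → IntersectingBound m (suc k)
intersecting-bound-step {m} {k} m≤k bound {n} {e} {S} ∣e∣≡1+k unique family intersecting =
  *-cancelʳ-≤ (2 * length S) (suc k C m) (suc k ∸ m) {{>-nonZero (m<n⇒0<n∸m (s≤s m≤k))}} (begin
    2 * length S * (suc k ∸ m)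
      ≡⟨ *-assoc 2 (length S) _ ⟩
    2 * (length S * (suc k ∸ m))
      ≡⟨ cong (2 *_) (∑-length-filter-∈ (e ─_) S sizes) ⟨
    2 * ∑[ x < n ] length (avoiding x e S)
      ≡⟨ *-distribˡ-sum 2 (λ x → length (avoiding x e S)) ⟩
    ∑[ x < n ] (2 * length (avoiding x e S))
      ≤⟨ ∑-mono-≤ (avoiding-bound bound ∣e∣≡1+k unique family intersecting) ⟩
    ∑[ x < n ] (indicator (x ∈? e) * (k C m))
      ≡⟨ *-distribʳ-sum (k C m) (λ x → indicator (x ∈? e)) ⟨
    (∑[ x < n ] indicator (x ∈? e)) * (k C m)
      ≡⟨ cong (_* (k C m)) (trans (∑-indicator-∈ e) ∣e∣≡1+k) ⟩
    suc k * (k C m)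
      ≡⟨ [n+1∸k]*[n+1]Ck≡[n+1]*nCk k m ⟨
    (suc k ∸ m) * (suc k C m)
      ≡⟨ *-comm (suc k ∸ m) _ ⟩
    (suc k C m) * (suc k ∸ m)
      ∎)
  where
  open ≤-Reasoning
  sizes : All (λ a → ∣ e ─ a ∣ ≡ suc k ∸ m) S
  sizes = All.map (λ (a⊆e , ∣a∣≡m) → trans (∣p─q∣≡∣p∣∸∣q∣ a⊆e) (cong₂ _∸_ ∣e∣≡1+k ∣a∣≡m)) family

intersecting-bound : ∀ {m k} → 2 * m ≤ k → IntersectingBound m k
intersecting-bound 2m≤k = go (≤⇒≤′ 2m≤k)
  where
  go : ∀ {m k} → 2 * m ≤′ k → IntersectingBound m k
  go {m} ≤′-refl         = intersecting-bound-base m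
  go {m} (≤′-step 2m≤′k) = intersecting-bound-step (≤-trans (m≤m+n m _) (≤′⇒≤ 2m≤′k)) (go 2m≤′k)

disjoint-pair? : ∀ {n} (S : List (Subset n)) → PairMeetingIn 0 S ⊎ Intersecting S
disjoint-pair? S with any? (λ a → any? (λ b → ∣ a ∩ b ∣ ≟ 0) S) S
... | yes found = let a , a∈S , found-b = find found ; b , b∈S , ∣a∩b∣≡0 = find found-b
                  in inj₁ (a , b , a∈S , b∈S , ∣a∩b∣≡0)
... | no none   = inj₂ (λ a∈S b∈S ∣a∩b∣≡0 → none (lose a∈S (lose b∈S ∣a∩b∣≡0)))

disjoint-pair : ∀ {m n} {e : Subset n} {S} → 2 * m ≤ ∣ e ∣ → Unique S → Family m e S →
                ∣ e ∣ C m < 2 * length S → PairMeetingIn 0 S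
disjoint-pair {S = S} 2m≤∣e∣ unique family big with disjoint-pair? S
... | inj₁ pair         = pair
... | inj₂ intersecting = contradiction (intersecting-bound 2m≤∣e∣ refl unique family intersecting) (<⇒≱ big)

complement-pair : ∀ {m n} {e : Subset n} {S} → m ≤ ∣ e ∣ → ∣ e ∣ ≤ 2 * m → Unique S → Family m e S →
                  ∣ e ∣ C m < 2 * length S → PairMeetingIn (2 * m ∸ ∣ e ∣) S
complement-pair {m} {e = e} {S} m≤∣e∣ ∣e∣≤2m unique family big
  with a′ , b′ , a′∈ , b′∈ , ∣a′∩b′∣≡0 ← disjoint-pair (2*[n∸m]≤n m≤∣e∣ ∣e∣≤2m)
         (complements-unique (All.map proj₁ family) unique) (complements-family family)
         (subst₂ (λ c l → c < 2 * l) (nCk≡nC[n∸k] m≤∣e∣) (sym (length-map (e ─_) S)) big)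
  with ∈-map⁻ (e ─_) a′∈ | ∈-map⁻ (e ─_) b′∈
... | a , a∈S , refl | b , b∈S , refl
  with a⊆e , ∣a∣≡m ← All.lookup family a∈S | b⊆e , ∣b∣≡m ← All.lookup family b∈S =
  a , b , a∈S , b∈S , (begin
    ∣ a ∩ b ∣
      ≡⟨ m+n∸n≡m ∣ a ∩ b ∣ ∣ e ∣ ⟨
    ∣ a ∩ b ∣ + ∣ e ∣ ∸ ∣ e ∣
      ≡⟨ cong (_∸ ∣ e ∣) (∣p∩q∣+∣r∣≡∣[r─p]∩[r─q]∣+∣p∣+∣q∣ a⊆e b⊆e) ⟩
    ∣ (e ─ a) ∩ (e ─ b) ∣ + ∣ a ∣ + ∣ b ∣ ∸ ∣ e ∣
      ≡⟨ cong (λ u → u + ∣ a ∣ + ∣ b ∣ ∸ ∣ e ∣) ∣a′∩b′∣≡0 ⟩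
    ∣ a ∣ + ∣ b ∣ ∸ ∣ e ∣
      ≡⟨ cong₂ (λ u v → u + v ∸ ∣ e ∣) ∣a∣≡m ∣b∣≡m ⟩
    m + m ∸ ∣ e ∣
      ≡⟨ cong (_∸ ∣ e ∣) (2*n≡n+n m) ⟨
    2 * m ∸ ∣ e ∣
      ∎)
  where open ≡-Reasoning

pair-meeting-in : ∀ {m n k} {e : Subset n} {S} → ∣ e ∣ ≡ k → m ≤ k → Unique S → Family m e S →
                  k C m < 2 * length S → PairMeetingIn (2 * m ∸ k) S
pair-meeting-in {m} {k = k} {S = S} refl m≤k unique family big with 2 * m ≤? k
... | yes 2m≤k = subst (λ t → PairMeetingIn t S) (sym (m≤n⇒m∸n≡0 2m≤k)) (disjoint-pair 2m≤k unique family big)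
... | no  2m≰k = complement-pair m≤k (<⇒≤ (≰⇒> 2m≰k)) unique family big

∣a∩b∣<∣a∣⇒a≢b : ∀ {n} {a b : Subset n} → ∣ a ∩ b ∣ < ∣ a ∣ → a ≢ b
∣a∩b∣<∣a∣⇒a≢b {a = a} ∣a∩a∣<∣a∣ refl = <-irrefl (cong ∣_∣ (∩-idem a)) ∣a∩a∣<∣a∣

lemma7 : (n k m : ℕ) → 2 ≤ m → m ≤ k ∸ 1 →
         (H : Hypergraph n) → IsUniform k H → MatchingNumber≡ m H 1 →
         (e : Subset n) → e ∈ edges H →
         (S : List (Subset n)) → Unique S →
         All (λ a → a ⊆ e × ∣ a ∣ ≡ m) S →
         k C m < 2 * length S →
         Σ (Subset n) (λ a → Σ (Subset n) (λ b →
           a ∈ S × b ∈ S × a ≢ b × ∣ a ∩ b ∣ ≡ (2 * m) ∸ k))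
lemma7 n k m 2≤m m≤k∸1 _ uniform _ e e∈H S unique family big =
  let a , b , a∈S , b∈S , ∣a∩b∣≡2m∸k = pair-meeting-in (All.lookup uniform e∈H) (<⇒≤ m<k) unique family big
      ∣a∩b∣<∣a∣ = subst₂ _<_ (sym ∣a∩b∣≡2m∸k) (sym (proj₂ (All.lookup family a∈S))) (2*m∸n<m 0<m m<k)
  in a , b , a∈S , b∈S , ∣a∩b∣<∣a∣⇒a≢b ∣a∩b∣<∣a∣ , ∣a∩b∣≡2m∸k
  where
  0<m : 0 < m
  0<m = ≤-trans (n≤1+n 1) 2≤m
  m<k : m < k
  m<k = m≤n∸1⇒m<n 0<m m≤k∸1
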